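{- Let $G_1$ be a reduced graph (as defined in the context). Then there is a maximum path-cycle cover of $G_1$ in which every path component of length $1$ has an endpoint that is adjacent, via an edge of $G_1$, to an inner vertex of a path component of length at least $3$.
   Context: Throughout, $G_1$ is a connected undirected simple graph which is not a tree and which is reduced, meaning: (R1) every edge of $G_1$ whose two ends are each adjacent to a leaf (degree-$1$ vertex) of $G_1$ is a cut edge of $G_1$; (R2) no cut vertex of $G_1$ adjacent to a leaf of $G_1$ is super (a cut vertex is super if deleting it increases the number of connected components by at least $2$). Moreover it is assumed that no maximum path-cycle cover of $G_1$ consists of a single connected component. A path-cycle cover of $G_1$ is a spanning subgraph in which every vertex has degree at most $2$; it is maximum if it has the maximum number of edges among all path-cycle covers. Its connected components are path components and cycle components; the length of a path is its number of edges. A vertex of a path component is inner if its degree in the path is $2$ and an endpoint otherwise. -}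

module Defs where

open import Data.Nat using (ℕ; zero; suc; _+_; _<_; _≤_)
open import Data.Bool using (Bool; true; false; _∧_; _∨_; not; if_then_else_)
open import Data.Fin using (Fin; toℕ; _≟_)
open import Data.List using (List; []; _∷_; _++_; length; map; allFin)
open import Data.Nat.ListAction using (sum)
open import Data.Empty using (⊥)
open import Data.List.Membership.Propositional using (_∈_)
open import Data.List.Relation.Unary.Unique.Propositional using (Unique)
open import Data.Product using (Σ; ∃; ∃-syntax; _×_; _,_)
open import Data.Sum using (_⊎_)
open import Relation.Binary.PropositionalEquality using (_≡_)
open import Relation.Nullary using (¬_; ⌊_⌋)
open import Data.Nat using (_<ᵇ_)

record Graph (n : ℕ) : Set where
  field
    adj    : Fin n → Fin n → Bool
    sym    : ∀ u v → adj u v ≡ adj v u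
    irrefl : ∀ v → adj v v ≡ false
open Graph public

EdgeRel : ℕ → Set
EdgeRel n = Fin n → Fin n → Bool

Mask : ℕ → Set
Mask n = Fin n → Bool

allV : ∀ {n} → Mask n
allV _ = true

minusV : ∀ {n} → Fin n → Mask n
minusV v w = not ⌊ v ≟ w ⌋

minusE : ∀ {n} → EdgeRel n → Fin n → Fin n → EdgeRel n
minusE A a b u w =
  A u w ∧ not ((⌊ u ≟ a ⌋ ∧ ⌊ w ≟ b ⌋) ∨ (⌊ u ≟ b ⌋ ∧ ⌊ w ≟ a ⌋))

data Reach {n : ℕ} (K : Mask n) (A : EdgeRel n) : Fin n → Fin n → Set where
  here : ∀ {u} → K u ≡ true → Reach K A u u
  step : ∀ {u w v} → K u ≡ true → A u w ≡ true → Reach K A w v → Reach K A u v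

-- "the subgraph (K, A) has exactly c connected components":
-- c representatives, pairwise in different components, covering all vertices.
NumComp : ∀ {n} → Mask n → EdgeRel n → ℕ → Set
NumComp {n} K A c =
  Σ (Fin c → Fin n) λ rep →
    (∀ i → K (rep i) ≡ true) ×
    (∀ i j → Reach K A (rep i) (rep j) → i ≡ j) ×
    (∀ v → K v ≡ true → ∃[ i ] Reach K A v (rep i))

Connected : ∀ {n} → Graph n → Set
Connected G = ∀ u v → Reach allV (adj G) u v

Consec : ∀ {n} → List (Fin n) → Fin n → Fin n → Set
Consec ws u v = ∃[ as ] ∃[ bs ] (ws ≡ as ++ u ∷ v ∷ bs)

lastOf : ∀ {n} → Fin n → List (Fin n) → Fin n
lastOf x [] = x
lastOf _ (y ∷ ys) = lastOf y ys

IsCycle : ∀ {n} → Graph n → List (Fin n) → Set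
IsCycle G [] = ⊥
IsCycle G (w ∷ ws) =
  (3 ≤ length (w ∷ ws)) × Unique (w ∷ ws) ×
  (∀ u v → Consec (w ∷ ws) u v → adj G u v ≡ true) ×
  (adj G (lastOf w ws) w ≡ true)

Acyclic : ∀ {n} → Graph n → Set
Acyclic {n} G = ∀ (ws : List (Fin n)) → ¬ IsCycle G ws

IsTree : ∀ {n} → Graph n → Set
IsTree G = Connected G × Acyclic G

deg : ∀ {n} → EdgeRel n → Fin n → ℕ
deg {n} A v = sum (map (λ w → if A v w then 1 else 0) (allFin n))

IsLeaf : ∀ {n} → Graph n → Fin n → Set
IsLeaf G v = deg (adj G) v ≡ 1

AdjLeaf : ∀ {n} → Graph n → Fin n → Set
AdjLeaf G v = ∃[ l ] (IsLeaf G l × adj G v l ≡ true)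

IsCutEdge : ∀ {n} → Graph n → Fin n → Fin n → Set
IsCutEdge G a b = adj G a b ≡ true ×
  (∀ c c' → NumComp allV (adj G) c → NumComp allV (minusE (adj G) a b) c' → c < c')

IsCutVertex : ∀ {n} → Graph n → Fin n → Set
IsCutVertex G v =
  ∀ c c' → NumComp allV (adj G) c → NumComp (minusV v) (adj G) c' → c < c'

IsSuper : ∀ {n} → Graph n → Fin n → Set
IsSuper G v =
  ∀ c c' → NumComp allV (adj G) c → NumComp (minusV v) (adj G) c' → c + 2 ≤ c'

Reduced : ∀ {n} → Graph n → Set
Reduced G =
  (∀ a b → adj G a b ≡ true → AdjLeaf G a → AdjLeaf G b → IsCutEdge G a b) ×
  (∀ v → IsCutVertex G v → AdjLeaf G v → ¬ IsSuper G v)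

-- path-cycle cover: spanning subgraph (edge subset) with max degree ≤ 2
IsPCC : ∀ {n} → Graph n → EdgeRel n → Set
IsPCC G C =
  (∀ u v → C u v ≡ true → adj G u v ≡ true) ×
  (∀ u v → C u v ≡ C v u) ×
  (∀ v → deg C v ≤ 2)

-- number of edges: unordered pairs {u,v} (counted once via toℕ u < toℕ v)
edgeCount : ∀ {n} → EdgeRel n → ℕ
edgeCount {n} C =
  sum (map (λ u → sum (map (λ v → if (toℕ u <ᵇ toℕ v) ∧ C u v then 1 else 0)
                            (allFin n)))
           (allFin n))

IsMaxPCC : ∀ {n} → Graph n → EdgeRel n → Set
IsMaxPCC {n} G C = IsPCC G C × (∀ (C' : EdgeRel n) → IsPCC G C' → edgeCount C' ≤ edgeCount C)

-- ws (in order) is the vertex sequence of a path component of the cover C: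
-- distinct vertices, consecutive ones joined by C, and every C-edge at a
-- vertex of ws joins consecutive vertices of ws (so the component is
-- closed and has exactly the path edges). Its length is length ws - 1.
IsPathComp : ∀ {n} → EdgeRel n → List (Fin n) → Set
IsPathComp C ws =
  (1 ≤ length ws) × Unique ws ×
  (∀ u v → Consec ws u v → C u v ≡ true) ×
  (∀ u v → u ∈ ws → C u v ≡ true → Consec ws u v ⊎ Consec ws v u)

IsInner : ∀ {n} → List (Fin n) → Fin n → Set
IsInner ws y = ∃[ a ] ∃[ as ] ∃[ b ] ∃[ bs ] (ws ≡ a ∷ as ++ y ∷ b ∷ bs)

-- Among the maximum path-cycle covers choose one, C, with the fewest path components of length 1;
-- the covers of G are finitely many edge relations, so an exhaustive search makes this choice.
-- Let ab be such a component. Since G is connected and not a tree it has a third vertex, so some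
-- y ∉ {a, b} is adjacent in G to a (say). If y had C-degree at most 1, adding ay would enlarge C;
-- so y has two C-neighbours p and q. If q had no C-neighbour r ≢ y of degree 1, replacing the
-- edge yq by ay would give a maximum cover with fewer components of length 1. Hence p and q have
-- such neighbours s and r, and s p y q r is a path component of length 4 with y inner.

module Submission where

open import Defs hiding (sym)
open import Data.Nat using (ℕ; zero; suc; _+_; _≤_; _<_; z≤n; s≤s; _<ᵇ_; _≡ᵇ_)
open import Data.Nat.Properties renaming (_≟_ to _≟ℕ_)
open import Data.Nat.ListAction using (sum)
open import Algebra.Properties.CommutativeMonoid.Sum +-0-commutativeMonoid
  using (sum-cong-≗; sum-remove; sum-replicate-zero) renaming (sum to ∑)
open import Data.Fin using (Fin; zero; suc; _≟_; toℕ; punchIn)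
open import Data.Fin.Properties using (punchInᵢ≢i; toℕ-injective; any?; all?)
open import Data.Fin.Subset using (Subset)
open import Data.Fin.Subset.Properties using (anySubset?)
open import Data.Bool using (Bool; true; false; _∧_; _∨_; not; if_then_else_)
open import Data.Bool.Properties
  using (∧-identityʳ; ∧-zeroʳ; ∨-identityʳ; ∨-zeroʳ; T-≡; ¬-not) renaming (_≟_ to _≟ᵇ_)
open import Data.List using (List; []; _∷_; length; map; allFin; tabulate)
open import Data.List.Properties using (map-tabulate; map-cong)
open import Data.List.Membership.Propositional using (_∈_)
open import Data.List.Relation.Unary.Any using (here; there)
open import Data.List.Relation.Unary.All using ([]; _∷_)
open import Data.List.Relation.Unary.AllPairs using ([]; _∷_)
open import Data.List.Relation.Unary.Unique.Propositional using (Unique)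
open import Data.Vec using (Vec; []; _∷_; lookup)
import Data.Vec as Vec
open import Data.Vec.Properties using (lookup∘tabulate)
open import Data.Product using (∃; ∃-syntax; _×_; _,_; proj₁; proj₂; map₂)
import Data.Product as Product
open import Data.Sum using (_⊎_; inj₁; inj₂; [_,_]′)
open import Data.Empty using (⊥; ⊥-elim)
open import Function using (_∘_; id; Equivalence)
open import Relation.Binary.PropositionalEquality
open import Relation.Binary.Definitions using (tri<; tri≈; tri>)
open import Relation.Nullary using (¬_; Dec; yes; no; ⌊_⌋; contradiction)
open import Relation.Nullary.Decidable using (_×-dec_; _⊎-dec_; _→-dec_; ¬?; map′; decidable-stable)
open import Relation.Unary using (Decidable)

-- Counting over Fin n

indicator : Bool → ℕ
indicator b = if b then 1 else 0

-- count is written like the sums in Defs.deg and Defs.edgeCount, so that deg A v is count (A v)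
-- by definition.
count : ∀ {n} → (Fin n → Bool) → ℕ
count {n} h = sum (map (indicator ∘ h) (allFin n))

sum-map-allFin : ∀ {n} (g : Fin n → ℕ) → sum (map g (allFin n)) ≡ ∑ g
sum-map-allFin {n} g = trans (cong sum (map-tabulate id g)) (sum-tabulate g)
  where
  sum-tabulate : ∀ {m} (f : Fin m → ℕ) → sum (tabulate f) ≡ ∑ f
  sum-tabulate {zero}  f = refl
  sum-tabulate {suc m} f = cong (f zero +_) (sum-tabulate (f ∘ suc))

∑-mono : ∀ {n} {f g : Fin n → ℕ} → (∀ i → f i ≤ g i) → ∑ f ≤ ∑ g
∑-mono {zero}  f≤g = z≤n
∑-mono {suc n} f≤g = +-mono-≤ (f≤g zero) (∑-mono (f≤g ∘ suc))

∑-mono-< : ∀ {n} {f g : Fin n → ℕ} (x : Fin n) → (∀ i → f i ≤ g i) → f x < g x → ∑ f < ∑ g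
∑-mono-< zero    f≤g fx<gx = +-mono-<-≤ fx<gx (∑-mono (f≤g ∘ suc))
∑-mono-< (suc x) f≤g fx<gx = +-mono-≤-< (f≤g zero) (∑-mono-< x (f≤g ∘ suc) fx<gx)

∑-suc-at : ∀ {n} {f g : Fin n → ℕ} (x : Fin n) → g x ≡ suc (f x) → (∀ i → i ≢ x → f i ≡ g i) →
           ∑ g ≡ suc (∑ f)
∑-suc-at {suc n} {f} {g} x gx f≗g = begin
  ∑ g                           ≡⟨ sum-remove g ⟩
  g x + ∑ (g ∘ punchIn x)       ≡⟨ cong₂ _+_ gx (sum-cong-≗ (λ j → sym (f≗g _ (punchInᵢ≢i x j)))) ⟩
  suc (f x + ∑ (f ∘ punchIn x)) ≡⟨ cong suc (sym (sum-remove f)) ⟩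
  suc (∑ f)                     ∎
  where open ≡-Reasoning

count≡∑ : ∀ {n} (h : Fin n → Bool) → count h ≡ ∑ (indicator ∘ h)
count≡∑ h = sum-map-allFin (indicator ∘ h)

indicator-mono : ∀ {b c} → (b ≡ true → c ≡ true) → indicator b ≤ indicator c
indicator-mono {false} b⇒c = z≤n
indicator-mono {true}  b⇒c rewrite b⇒c refl = ≤-refl

count-cong : ∀ {n} {h h′ : Fin n → Bool} → (∀ i → h i ≡ h′ i) → count h ≡ count h′
count-cong {n} h≗h′ = cong sum (map-cong (cong indicator ∘ h≗h′) (allFin n))

count-mono : ∀ {n} {h h′ : Fin n → Bool} → (∀ i → h i ≡ true → h′ i ≡ true) → count h ≤ count h′
count-mono {h = h} {h′} h⊆h′ =
  subst₂ _≤_ (sym (count≡∑ h)) (sym (count≡∑ h′)) (∑-mono (λ i → indicator-mono (h⊆h′ i)))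

count-mono-< : ∀ {n} {h h′ : Fin n → Bool} (x : Fin n) → (∀ i → h i ≡ true → h′ i ≡ true) →
               h x ≡ false → h′ x ≡ true → count h < count h′
count-mono-< {h = h} {h′} x h⊆h′ hx h′x =
  subst₂ _<_ (sym (count≡∑ h)) (sym (count≡∑ h′)) (∑-mono-< x (λ i → indicator-mono (h⊆h′ i)) at-x)
  where
  at-x : indicator (h x) < indicator (h′ x)
  at-x rewrite hx | h′x = ≤-refl

count-suc-at : ∀ {n} {h h′ : Fin n → Bool} (x : Fin n) → h x ≡ false → h′ x ≡ true →
               (∀ i → i ≢ x → h i ≡ h′ i) → count h′ ≡ suc (count h)
count-suc-at {h = h} {h′} x hx h′x h≗h′ = begin
  count h′                ≡⟨ count≡∑ h′ ⟩
  ∑ (indicator ∘ h′)      ≡⟨ ∑-suc-at x at-x (λ i i≢x → cong indicator (h≗h′ i i≢x)) ⟩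
  suc (∑ (indicator ∘ h)) ≡⟨ cong suc (sym (count≡∑ h)) ⟩
  suc (count h)           ∎
  where
  open ≡-Reasoning
  at-x : indicator (h′ x) ≡ suc (indicator (h x))
  at-x rewrite hx | h′x = refl

count-none : ∀ {n} {h : Fin n → Bool} → (∀ i → h i ≡ false) → count h ≡ 0
count-none {n} {h} none =
  trans (count≡∑ h) (trans (sum-cong-≗ (cong indicator ∘ none)) (sum-replicate-zero n))

count-≤ : ∀ {n} (h : Fin n → Bool) → count h ≤ ∑ {n} (λ _ → 1)
count-≤ h = subst (_≤ _) (sym (count≡∑ h)) (∑-mono (λ i → indicator-≤1 (h i)))
  where
  indicator-≤1 : ∀ b → indicator b ≤ 1
  indicator-≤1 false = z≤n
  indicator-≤1 true  = ≤-refl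

_without_ : ∀ {n} → (Fin n → Bool) → Fin n → Fin n → Bool
(h without x) i = h i ∧ not ⌊ i ≟ x ⌋

without-≢ : ∀ {n} (h : Fin n → Bool) {x i : Fin n} → i ≢ x → (h without x) i ≡ h i
without-≢ h {x} {i} i≢x with i ≟ x
... | yes i≡x = contradiction i≡x i≢x
... | no  _   = ∧-identityʳ (h i)

without-true : ∀ {n} (h : Fin n → Bool) {x i : Fin n} → (h without x) i ≡ true → h i ≡ true × i ≢ x
without-true h {x} {i} hi-x with i ≟ x
... | yes _   = contradiction (trans (sym (∧-zeroʳ (h i))) hi-x) λ ()
... | no  i≢x = trans (sym (∧-identityʳ (h i))) hi-x , i≢x

count-without : ∀ {n} (h : Fin n → Bool) {x : Fin n} → h x ≡ true → count h ≡ suc (count (h without x))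
count-without h {x} hx = count-suc-at x removed hx (λ i i≢x → without-≢ h i≢x)
  where
  removed : (h without x) x ≡ false
  removed with x ≟ x
  ... | yes _   = ∧-zeroʳ (h x)
  ... | no  x≢x = contradiction refl x≢x

count-pos : ∀ {n} {h : Fin n → Bool} {x : Fin n} → h x ≡ true → 1 ≤ count h
count-pos {h = h} hx rewrite count-without h hx = s≤s z≤n

count≥2 : ∀ {n} {h : Fin n → Bool} {x z : Fin n} → h x ≡ true → h z ≡ true → z ≢ x → 2 ≤ count h
count≥2 {h = h} {x} hx hz z≢x rewrite count-without h hx =
  s≤s (count-pos {h = h without x} (trans (without-≢ h z≢x) hz))

count≡1-unique : ∀ {n} {h : Fin n → Bool} {x w : Fin n} → count h ≡ 1 → h x ≡ true → h w ≡ true → w ≡ x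
count≡1-unique {h = h} {x} {w} c≡1 hx hw with w ≟ x
... | yes w≡x = w≡x
... | no  w≢x = contradiction (subst (1 ≤_) (suc-injective (trans (sym (count-without h hx)) c≡1)) pos) λ ()
  where
  pos : 1 ≤ count (h without x)
  pos = count-pos {h = h without x} (trans (without-≢ h w≢x) hw)

count≡2-cases : ∀ {n} {h : Fin n → Bool} {x z w : Fin n} → count h ≡ 2 → h x ≡ true → h z ≡ true →
                z ≢ x → h w ≡ true → w ≡ x ⊎ w ≡ z
count≡2-cases {h = h} {x} {z} {w} c≡2 hx hz z≢x hw with w ≟ x
... | yes w≡x = inj₁ w≡x
... | no  w≢x = inj₂ (count≡1-unique {h = h without x} (suc-injective (trans (sym (count-without h hx)) c≡2))
                        (trans (without-≢ h z≢x) hz) (trans (without-≢ h w≢x) hw))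

count≡1 : ∀ {n} {h : Fin n → Bool} {x : Fin n} → h x ≡ true → (∀ w → h w ≡ true → w ≡ x) → count h ≡ 1
count≡1 {h = h} {x} hx unique = trans (count-without h hx) (cong suc (count-none none))
  where
  none : ∀ i → (h without x) i ≡ false
  none i with (h without x) i in hi-x
  ... | true  = contradiction (unique i (proj₁ (without-true h hi-x))) (proj₂ (without-true h hi-x))
  ... | false = refl

count-pos-witness : ∀ {n} (h : Fin n → Bool) → 1 ≤ count h → ∃[ x ] h x ≡ true
count-pos-witness h pos with any? (λ i → h i ≟ᵇ true)
... | yes found = found
... | no  none  = contradiction (subst (1 ≤_) (count-none (λ i → ¬-not (none ∘ (i ,_)))) pos) λ ()

count≡2-witnesses : ∀ {n} (h : Fin n → Bool) → count h ≡ 2 → ∃[ x ] ∃[ z ] (h x ≡ true × h z ≡ true × x ≢ z)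
count≡2-witnesses h c≡2 with count-pos-witness h (subst (1 ≤_) (sym c≡2) (s≤s z≤n))
... | z , hz with count-pos-witness (h without z)
                    (subst (1 ≤_) (sym (suc-injective (trans (sym (count-without h hz)) c≡2))) ≤-refl)
... | x , hx-z = x , z , proj₁ (without-true h hx-z) , hz , proj₂ (without-true h hx-z)

-- Adding one edge to a relation

_≐_ : ∀ {n} → EdgeRel n → EdgeRel n → Set
A ≐ B = ∀ u w → A u w ≡ B u w

Symmetric : ∀ {n} → EdgeRel n → Set
Symmetric A = ∀ u w → A u w ≡ A w u

IsPair : ∀ {n} → Fin n → Fin n → Fin n → Fin n → Set
IsPair a b u w = (u ≡ a × w ≡ b) ⊎ (u ≡ b × w ≡ a)

isPair? : ∀ {n} (a b u w : Fin n) → Dec (IsPair a b u w)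
isPair? a b u w = (u ≟ a ×-dec w ≟ b) ⊎-dec (u ≟ b ×-dec w ≟ a)

IsPair-flip : ∀ {n} {a b u w : Fin n} → IsPair a b u w → IsPair a b w u
IsPair-flip = [ inj₂ ∘ Product.swap , inj₁ ∘ Product.swap ]′

IsPair-swap : ∀ {n} {a b u w : Fin n} → IsPair a b u w → IsPair b a u w
IsPair-swap = [ inj₂ , inj₁ ]′

-- the Boolean test inside Defs.minusE
pair : ∀ {n} → Fin n → Fin n → Fin n → Fin n → Bool
pair a b u w = (⌊ u ≟ a ⌋ ∧ ⌊ w ≟ b ⌋) ∨ (⌊ u ≟ b ⌋ ∧ ⌊ w ≟ a ⌋)

⌊≟⌋-refl : ∀ {n} (x : Fin n) → ⌊ x ≟ x ⌋ ≡ true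
⌊≟⌋-refl x with x ≟ x
... | yes _   = refl
... | no  x≢x = contradiction refl x≢x

pair-complete : ∀ {n} {a b u w : Fin n} → IsPair a b u w → pair a b u w ≡ true
pair-complete {a = a} {b} (inj₁ (refl , refl)) rewrite ⌊≟⌋-refl a | ⌊≟⌋-refl b = refl
pair-complete {a = a} {b} (inj₂ (refl , refl)) rewrite ⌊≟⌋-refl a | ⌊≟⌋-refl b = ∨-zeroʳ _

pair-sound : ∀ {n} {a b u w : Fin n} → pair a b u w ≡ true → IsPair a b u w
pair-sound {a = a} {b} {u} {w} p with u ≟ a | w ≟ b | u ≟ b | w ≟ a
... | yes u≡a | yes w≡b | _       | _       = inj₁ (u≡a , w≡b)
... | _       | _       | yes u≡b | yes w≡a = inj₂ (u≡b , w≡a)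

pair-false : ∀ {n} {a b u w : Fin n} → ¬ IsPair a b u w → pair a b u w ≡ false
pair-false {a = a} {b} {u} {w} ¬p with pair a b u w in e
... | true  = contradiction (pair-sound e) ¬p
... | false = refl

record AddsEdge {n} (A B : EdgeRel n) (a b : Fin n) : Set where
  field
    distinct  : a ≢ b
    absent    : ∀ {u w} → IsPair a b u w → A u w ≡ false
    present   : ∀ {u w} → IsPair a b u w → B u w ≡ true
    unchanged : ∀ {u w} → ¬ IsPair a b u w → A u w ≡ B u w

module _ {n} {A B : EdgeRel n} {a b : Fin n} (A+ab≡B : AddsEdge A B a b) where
  open AddsEdge A+ab≡B

  AddsEdge-swap : AddsEdge A B b a
  AddsEdge-swap = record
    { distinct  = distinct ∘ sym
    ; absent    = absent ∘ IsPair-swap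
    ; present   = present ∘ IsPair-swap
    ; unchanged = λ ¬ba → unchanged (¬ba ∘ IsPair-swap)
    }

  AddsEdge-⊆ : ∀ {u w} → A u w ≡ true → B u w ≡ true
  AddsEdge-⊆ {u} {w} Auw with isPair? a b u w
  ... | yes p  = present p
  ... | no  ¬p = trans (sym (unchanged ¬p)) Auw

  AddsEdge-sym : Symmetric A → Symmetric B
  AddsEdge-sym A-sym u w with isPair? a b u w
  ... | yes p  = trans (present p) (sym (present (IsPair-flip p)))
  ... | no  ¬p = trans (sym (unchanged ¬p)) (trans (A-sym u w) (unchanged (¬p ∘ IsPair-flip)))

  AddsEdge-sym⁻ : Symmetric B → Symmetric A
  AddsEdge-sym⁻ B-sym u w with isPair? a b u w
  ... | yes p  = trans (absent p) (sym (absent (IsPair-flip p)))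
  ... | no  ¬p = trans (unchanged ¬p) (trans (B-sym u w) (sym (unchanged (¬p ∘ IsPair-flip))))

  deg-AddsEdge : deg B a ≡ suc (deg A a)
  deg-AddsEdge = count-suc-at {h = A a} {B a} b
    (absent (inj₁ (refl , refl))) (present (inj₁ (refl , refl)))
    (λ w w≢b → unchanged [ w≢b ∘ proj₂ , distinct ∘ proj₁ ]′)

  deg-AddsEdge-other : ∀ {v} → v ≢ a → v ≢ b → deg B v ≡ deg A v
  deg-AddsEdge-other {v} v≢a v≢b =
    count-cong {h = B v} {A v} (λ w → sym (unchanged [ v≢a ∘ proj₁ , v≢b ∘ proj₁ ]′))

  deg-AddsEdge-≤ : ∀ v → deg A v ≤ deg B v
  deg-AddsEdge-≤ v = count-mono {h = A v} {B v} (λ w → AddsEdge-⊆)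

addEdge : ∀ {n} → EdgeRel n → Fin n → Fin n → EdgeRel n
addEdge A a b u w = A u w ∨ pair a b u w

addEdge-AddsEdge : ∀ {n} {A : EdgeRel n} {a b : Fin n} → a ≢ b →
                   (∀ {u w} → IsPair a b u w → A u w ≡ false) → AddsEdge A (addEdge A a b) a b
addEdge-AddsEdge {A = A} {a} {b} a≢b absent = record
  { distinct  = a≢b
  ; absent    = absent
  ; present   = λ {u} {w} p → trans (cong (A u w ∨_) (pair-complete p)) (∨-zeroʳ (A u w))
  ; unchanged = λ {u} {w} ¬p → sym (trans (cong (A u w ∨_) (pair-false ¬p)) (∨-identityʳ (A u w)))
  }

minusE-AddsEdge : ∀ {n} {A : EdgeRel n} {a b : Fin n} → a ≢ b →
                  (∀ {u w} → IsPair a b u w → A u w ≡ true) → AddsEdge (minusE A a b) A a b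
minusE-AddsEdge {A = A} {a} {b} a≢b present = record
  { distinct  = a≢b
  ; absent    = λ {u} {w} p → trans (cong (λ x → A u w ∧ not x) (pair-complete p)) (∧-zeroʳ (A u w))
  ; present   = present
  ; unchanged = λ {u} {w} ¬p → trans (cong (λ x → A u w ∧ not x) (pair-false ¬p)) (∧-identityʳ (A u w))
  }

edgeRow : ∀ {n} → EdgeRel n → Fin n → ℕ
edgeRow A u = count (λ w → (toℕ u <ᵇ toℕ w) ∧ A u w)

edgeCount≡∑ : ∀ {n} (A : EdgeRel n) → edgeCount A ≡ ∑ (edgeRow A)
edgeCount≡∑ A = sum-map-allFin (edgeRow A)

edgeCount-cong : ∀ {n} {A B : EdgeRel n} → A ≐ B → edgeCount A ≡ edgeCount B
edgeCount-cong {A = A} {B} A≐B = begin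
  edgeCount A     ≡⟨ edgeCount≡∑ A ⟩
  ∑ (edgeRow A)   ≡⟨ sum-cong-≗ (λ u → count-cong (λ w → cong ((toℕ u <ᵇ toℕ w) ∧_) (A≐B u w))) ⟩
  ∑ (edgeRow B)   ≡⟨ edgeCount≡∑ B ⟨
  edgeCount B     ∎
  where open ≡-Reasoning

<ᵇ-true : ∀ {m k} → m < k → (m <ᵇ k) ≡ true
<ᵇ-true m<k = Equivalence.to T-≡ (<⇒<ᵇ m<k)

<ᵇ-false : ∀ {m k} → k < m → (m <ᵇ k) ≡ false
<ᵇ-false {m} {k} k<m with m <ᵇ k in e
... | true  = contradiction (<ᵇ⇒< m k (Equivalence.from T-≡ e)) (<-asym k<m)
... | false = refl

edgeCount-AddsEdge-< : ∀ {n} {A B : EdgeRel n} {a b : Fin n} → AddsEdge A B a b → toℕ a < toℕ b →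
                       edgeCount B ≡ suc (edgeCount A)
edgeCount-AddsEdge-< {A = A} {B} {a} {b} A+ab≡B a<b = begin
  edgeCount B         ≡⟨ edgeCount≡∑ B ⟩
  ∑ (edgeRow B)       ≡⟨ ∑-suc-at a row-a other-rows ⟩
  suc (∑ (edgeRow A)) ≡⟨ cong suc (edgeCount≡∑ A) ⟨
  suc (edgeCount A)   ∎
  where
  open ≡-Reasoning
  open AddsEdge A+ab≡B
  row-a : edgeRow B a ≡ suc (edgeRow A a)
  row-a = count-suc-at b
    (trans (cong (_ ∧_) (absent (inj₁ (refl , refl)))) (∧-zeroʳ _))
    (cong₂ _∧_ (<ᵇ-true a<b) (present (inj₁ (refl , refl))))
    (λ w w≢b → cong (_ ∧_) (unchanged [ w≢b ∘ proj₂ , distinct ∘ proj₁ ]′))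
  other-rows : ∀ u → u ≢ a → edgeRow A u ≡ edgeRow B u
  other-rows u u≢a = count-cong entry
    where
    entry : ∀ w → ((toℕ u <ᵇ toℕ w) ∧ A u w) ≡ ((toℕ u <ᵇ toℕ w) ∧ B u w)
    entry w with isPair? a b u w
    ... | no ¬p = cong (_ ∧_) (unchanged ¬p)
    ... | yes (inj₁ (u≡a , _)) = contradiction u≡a u≢a
    ... | yes (inj₂ (refl , refl)) rewrite <ᵇ-false a<b = refl

edgeCount-AddsEdge : ∀ {n} {A B : EdgeRel n} {a b : Fin n} → AddsEdge A B a b →
                     edgeCount B ≡ suc (edgeCount A)
edgeCount-AddsEdge {A = A} {B} {a} {b} A+ab≡B with <-cmp (toℕ a) (toℕ b)
... | tri< a<b _ _ = edgeCount-AddsEdge-< A+ab≡B a<b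
... | tri≈ _ a≡b _ = contradiction (toℕ-injective a≡b) (AddsEdge.distinct A+ab≡B)
... | tri> _ _ b<a = edgeCount-AddsEdge-< (AddsEdge-swap A+ab≡B) b<a

-- Path-cycle covers

IsPCC-extend : ∀ {n} {G : Graph n} {A B : EdgeRel n} {a b : Fin n} → IsPCC G A → AddsEdge A B a b →
               adj G a b ≡ true → deg A a ≤ 1 → deg A b ≤ 1 → IsPCC G B
IsPCC-extend {G = G} {A} {B} {a} {b} (A⊆G , A-sym , A-deg) A+ab≡B ab∈G da db =
  B⊆G , AddsEdge-sym A+ab≡B A-sym , B-deg
  where
  open AddsEdge A+ab≡B
  B⊆G : ∀ u w → B u w ≡ true → adj G u w ≡ true
  B⊆G u w Buw with isPair? a b u w
  ... | yes (inj₁ (refl , refl)) = ab∈G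
  ... | yes (inj₂ (refl , refl)) = trans (Graph.sym G u w) ab∈G
  ... | no ¬p = A⊆G u w (trans (unchanged ¬p) Buw)
  B-deg : ∀ v → deg B v ≤ 2
  B-deg v with v ≟ a | v ≟ b
  ... | yes refl | _        = subst (_≤ 2) (sym (deg-AddsEdge A+ab≡B)) (s≤s da)
  ... | no _     | yes refl = subst (_≤ 2) (sym (deg-AddsEdge (AddsEdge-swap A+ab≡B))) (s≤s db)
  ... | no v≢a   | no v≢b   = subst (_≤ 2) (sym (deg-AddsEdge-other A+ab≡B v≢a v≢b)) (A-deg v)

IsPCC-shrink : ∀ {n} {G : Graph n} {A B : EdgeRel n} {a b : Fin n} → IsPCC G B → AddsEdge A B a b → IsPCC G A
IsPCC-shrink (B⊆G , B-sym , B-deg) A+ab≡B =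
  (λ u w → B⊆G u w ∘ AddsEdge-⊆ A+ab≡B) ,
  AddsEdge-sym⁻ A+ab≡B B-sym ,
  (λ v → ≤-trans (deg-AddsEdge-≤ A+ab≡B v) (B-deg v))

deg-cong : ∀ {n} {A B : EdgeRel n} → A ≐ B → ∀ v → deg A v ≡ deg B v
deg-cong {A = A} {B} A≐B v = count-cong {h = A v} {B v} (A≐B v)

IsPCC-cong : ∀ {n} {G : Graph n} {A B : EdgeRel n} → A ≐ B → IsPCC G A → IsPCC G B
IsPCC-cong {A = A} {B} A≐B (A⊆G , A-sym , A-deg) =
  (λ u w → A⊆G u w ∘ trans (A≐B u w)) ,
  (λ u w → trans (sym (A≐B u w)) (trans (A-sym u w) (A≐B w u))) ,
  (λ v → subst (_≤ 2) (deg-cong A≐B v) (A-deg v))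

IsPCC? : ∀ {n} (G : Graph n) (A : EdgeRel n) → Dec (IsPCC G A)
IsPCC? G A =
  all? (λ u → all? (λ w → (A u w ≟ᵇ true) →-dec (adj G u w ≟ᵇ true))) ×-dec
  all? (λ u → all? (λ w → A u w ≟ᵇ A w u)) ×-dec
  all? (λ v → deg A v ≤? 2)

isEnd : ∀ {n} → EdgeRel n → Fin n → Bool
isEnd A v = deg A v ≡ᵇ 1

single : ∀ {n} → EdgeRel n → Fin n → Fin n → Bool
single A v w = A v w ∧ isEnd A v ∧ isEnd A w

-- twice the number of path components of length 1 of a path-cycle cover
singleEdges : ∀ {n} → EdgeRel n → ℕ
singleEdges A = ∑ λ v → count (single A v)

singleEdges-cong : ∀ {n} {A B : EdgeRel n} → A ≐ B → singleEdges A ≡ singleEdges B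
singleEdges-cong {A = A} {B} A≐B = sum-cong-≗ λ v → count-cong λ w →
  cong₂ _∧_ (A≐B v w) (cong₂ _∧_ (cong (_≡ᵇ 1) (deg-cong A≐B v)) (cong (_≡ᵇ 1) (deg-cong A≐B w)))

isEnd-sound : ∀ {n} {A : EdgeRel n} {v} → isEnd A v ≡ true → deg A v ≡ 1
isEnd-sound {A = A} {v} e = ≡ᵇ⇒≡ (deg A v) 1 (Equivalence.from T-≡ e)

single-sound : ∀ {n} {A : EdgeRel n} {v w} → single A v w ≡ true → A v w ≡ true × deg A v ≡ 1 × deg A w ≡ 1
single-sound {A = A} {v} {w} e with A v w | isEnd A v in ev | isEnd A w in ew
... | true | true | true = refl , isEnd-sound {A = A} ev , isEnd-sound {A = A} ew

single-complete : ∀ {n} {A : EdgeRel n} {v w} → A v w ≡ true → deg A v ≡ 1 → deg A w ≡ 1 → single A v w ≡ true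
single-complete {A = A} {v} {w} Avw dv dw rewrite Avw | dv | dw = refl

single-not-end : ∀ {n} {A : EdgeRel n} {v} w → deg A v ≢ 1 → single A v w ≡ false
single-not-end {A = A} {v} w dv≢1 with isEnd A v in ev
... | true  = contradiction (isEnd-sound {A = A} ev) dv≢1
... | false = ∧-zeroʳ (A v w)

-- A maximum cover with the fewest components of length 1

anyVec? : ∀ {A : Set} → (∀ {P : A → Set} → Decidable P → Dec (∃ P)) →
          ∀ {m} {P : Vec A m → Set} → Decidable P → Dec (∃ P)
anyVec? anyA {zero}  P? = map′ ([] ,_) (λ { ([] , p) → p }) (P? [])
anyVec? anyA {suc m} P? =
  map′ (λ (x , xs , p) → x ∷ xs , p) (λ { (x ∷ xs , p) → x , xs , p })
       (anyA (λ x → anyVec? anyA (P? ∘ (x ∷_))))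

-- An EdgeRel is a function, so the search runs over its matrix and P has to respect ≐.
anyEdgeRel? : ∀ {n} {P : EdgeRel n → Set} → (∀ {A B} → A ≐ B → P A → P B) → Decidable P → Dec (∃ P)
anyEdgeRel? {n} {P} resp P? =
  map′ (λ (V , p) → toRel V , p) (λ (A , p) → fromRel A , resp (λ u w → sym (toRel-fromRel A u w)) p)
       (anyVec? anySubset? (P? ∘ toRel))
  where
  toRel : Vec (Subset n) n → EdgeRel n
  toRel V u w = lookup (lookup V u) w
  fromRel : EdgeRel n → Vec (Subset n) n
  fromRel A = Vec.tabulate (Vec.tabulate ∘ A)
  toRel-fromRel : ∀ A → toRel (fromRel A) ≐ A
  toRel-fromRel A u w =
    trans (cong (λ r → lookup r w) (lookup∘tabulate (Vec.tabulate ∘ A) u)) (lookup∘tabulate (A u) w)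

module _ {X : Set} (P : X → Set) (f : X → ℕ) where

  maximum-exists : (∀ m → Dec (∃[ x ] (P x × m ≤ f x))) → ∀ B → (∀ x → P x → f x ≤ B) → ∃ P →
                   ∃[ x ] (P x × ∀ y → P y → f y ≤ f x)
  maximum-exists P≥? B bounded (x₀ , px₀) = search B bounded
    where
    search : ∀ k → (∀ y → P y → f y ≤ k) → ∃[ x ] (P x × ∀ y → P y → f y ≤ f x)
    search k below with P≥? k
    ... | yes (x , px , k≤fx) = x , px , λ y py → ≤-trans (below y py) k≤fx
    search zero    below | no none = contradiction (x₀ , px₀ , z≤n) none
    search (suc k) _     | no none = search k λ y py → ≤-pred (≰⇒> λ k<fy → none (y , py , k<fy))

  minimum-exists : (∀ m → Dec (∃[ x ] (P x × f x ≤ m))) → ∃ P → ∃[ x ] (P x × ∀ y → P y → f x ≤ f y)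
  minimum-exists P≤? (x₀ , px₀) = search (f x₀) (x₀ , px₀ , ≤-refl)
    where
    search : ∀ k → ∃[ x ] (P x × f x ≤ k) → ∃[ x ] (P x × ∀ y → P y → f x ≤ f y)
    search zero    (x , px , fx≤0) = x , px , λ _ _ → ≤-trans fx≤0 z≤n
    search (suc k) (x , px , fx≤k+1) with P≤? k
    ... | yes below = search k below
    ... | no  none  = x , px , λ y py → ≤-trans fx≤k+1 (≰⇒> (λ fy≤k → none (y , py , fy≤k)))

record Optimal {n} (G : Graph n) (C : EdgeRel n) : Set where
  field
    maximum             : IsMaxPCC G C
    fewest-single-edges : ∀ C′ → IsMaxPCC G C′ → singleEdges C ≤ singleEdges C′

optimal-exists : ∀ {n} (G : Graph n) → ∃ (Optimal G)
optimal-exists {n} G = refine (maximum-exists (IsPCC G) edgeCount longer? _ bound (empty , empty-PCC))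
  where
  empty : EdgeRel n
  empty _ _ = false
  empty-PCC : IsPCC G empty
  empty-PCC = (λ _ _ ()) , (λ _ _ → refl) ,
              λ v → subst (_≤ 2) (sym (count-none {h = empty v} λ _ → refl)) z≤n
  bound : ∀ A → IsPCC G A → edgeCount A ≤ ∑ {n} λ _ → ∑ {n} λ _ → 1
  bound A _ = subst (_≤ _) (sym (edgeCount≡∑ A)) (∑-mono λ u → count-≤ (λ w → (toℕ u <ᵇ toℕ w) ∧ A u w))
  longer? : ∀ m → Dec (∃[ A ] (IsPCC G A × m ≤ edgeCount A))
  longer? m = anyEdgeRel?
    (λ A≐B (pcc , m≤) → IsPCC-cong {G = G} A≐B pcc , subst (m ≤_) (edgeCount-cong A≐B) m≤)
    (λ A → IsPCC? G A ×-dec m ≤? edgeCount A)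
  SameSize : EdgeRel n → EdgeRel n → Set
  SameSize M A = IsPCC G A × edgeCount A ≡ edgeCount M
  fewer? : ∀ M m → Dec (∃[ A ] (SameSize M A × singleEdges A ≤ m))
  fewer? M m = anyEdgeRel?
    (λ A≐B ((pcc , A≡M) , A≤) → (IsPCC-cong {G = G} A≐B pcc , trans (sym (edgeCount-cong A≐B)) A≡M) ,
                                 subst (_≤ m) (singleEdges-cong A≐B) A≤)
    (λ A → (IsPCC? G A ×-dec edgeCount A ≟ℕ edgeCount M) ×-dec singleEdges A ≤? m)
  refine : ∃[ M ] (IsPCC G M × ∀ A → IsPCC G A → edgeCount A ≤ edgeCount M) → ∃ (Optimal G)
  refine (M , M-pcc , M-max) with minimum-exists (SameSize M) singleEdges (fewer? M) (M , M-pcc , refl)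
  ... | C , (C-pcc , C≡M) , C-min = C , record
    { maximum             = C-pcc , λ A A-pcc → subst (edgeCount A ≤_) (sym C≡M) (M-max A A-pcc)
    ; fewest-single-edges = λ A (A-pcc , A-max) →
        C-min A (A-pcc , ≤-antisym (M-max A A-pcc) (A-max M M-pcc))
    }

-- Around a path component of length 1

record IsolatedEdge {n} (C : EdgeRel n) (a b : Fin n) : Set where
  field
    edge   : C a b ≡ true
    only-a : ∀ {w} → C a w ≡ true → w ≡ b
    only-b : ∀ {w} → C b w ≡ true → w ≡ a

IsolatedEdge-flip : ∀ {n} {C : EdgeRel n} {a b : Fin n} → Symmetric C →
                    IsolatedEdge C a b → IsolatedEdge C b a
IsolatedEdge-flip C-sym e = record { edge = trans (C-sym _ _) edge ; only-a = only-b ; only-b = only-a }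
  where open IsolatedEdge e

IsolatedEdge-deg : ∀ {n} {C : EdgeRel n} {a b : Fin n} → IsolatedEdge C a b → deg C a ≡ 1
IsolatedEdge-deg {C = C} {a} e = count≡1 {h = C a} (IsolatedEdge.edge e) λ _ → IsolatedEdge.only-a e

IsolatedEdge-absent : ∀ {n} {C : EdgeRel n} {a b y : Fin n} → IsolatedEdge C a b → y ≢ b → C a y ≡ false
IsolatedEdge-absent {C = C} {a} {b} {y} e y≢b with C a y in Cay
... | true  = contradiction (IsolatedEdge.only-a e Cay) y≢b
... | false = refl

EndBeyond : ∀ {n} → EdgeRel n → Fin n → Fin n → Set
EndBeyond C y q = ∃[ r ] (C q r ≡ true × r ≢ y × deg C r ≡ 1)

endBeyond? : ∀ {n} (C : EdgeRel n) (y q : Fin n) → Dec (EndBeyond C y q)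
endBeyond? C y q = any? λ r → (C q r ≟ᵇ true) ×-dec ¬? (r ≟ y) ×-dec (deg C r ≟ℕ 1)

module _ {n} {G : Graph n} {C : EdgeRel n} (C-pcc : IsPCC G C) where

  C-sym : Symmetric C
  C-sym = proj₁ (proj₂ C-pcc)

  C-flip : ∀ {u w} → C u w ≡ true → C w u ≡ true
  C-flip {u} {w} Cuw = trans (C-sym w u) Cuw

  C-irrefl : ∀ {u w} → C u w ≡ true → u ≢ w
  C-irrefl {u} Cuu refl = contradiction (trans (sym (proj₁ C-pcc u u Cuu)) (Graph.irrefl G u)) λ ()

  C-deg : ∀ v → deg C v ≤ 2
  C-deg = proj₂ (proj₂ C-pcc)

  long-path-through : ∀ {y p q} → deg C y ≡ 2 → C y p ≡ true → C y q ≡ true → p ≢ q →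
                      EndBeyond C y p → EndBeyond C y q →
                      ∃[ ws ] (IsPathComp C ws × 4 ≤ length ws × IsInner ws y)
  long-path-through {y} {p} {q} dy yp yq p≢q (s , ps , s≢y , ds) (r , qr , r≢y , dr) =
    ws , (s≤s z≤n , distinct , joined , closed) , s≤s (s≤s (s≤s (s≤s z≤n))) , (s , p ∷ [] , q , r ∷ [] , refl)
    where
    ws : List (Fin n)
    ws = s ∷ p ∷ y ∷ q ∷ r ∷ []
    dp : deg C p ≡ 2
    dp = ≤-antisym (C-deg p) (count≥2 {h = C p} (C-flip yp) ps s≢y)
    dq : deg C q ≡ 2
    dq = ≤-antisym (C-deg q) (count≥2 {h = C q} (C-flip yq) qr r≢y)
    distinct : Unique ws
    distinct = (C-irrefl (C-flip ps) ∷ s≢y ∷ s≢q ∷ s≢r ∷ [])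
             ∷ (C-irrefl (C-flip yp) ∷ p≢q ∷ p≢r ∷ [])
             ∷ (C-irrefl yq ∷ r≢y ∘ sym ∷ [])
             ∷ (C-irrefl qr ∷ [])
             ∷ [] ∷ []
      where
      s≢q : s ≢ q
      s≢q refl = C-irrefl yp (count≡1-unique {h = C s} ds (C-flip ps) (C-flip yq))
      s≢r : s ≢ r
      s≢r refl = p≢q (sym (count≡1-unique {h = C s} ds (C-flip ps) (C-flip qr)))
      p≢r : p ≢ r
      p≢r refl = C-irrefl yq (count≡1-unique {h = C p} dr (C-flip qr) (C-flip yp))
    s-p : Consec ws s p
    s-p = [] , _ , refl
    p-y : Consec ws p y
    p-y = (s ∷ []) , _ , refl
    y-q : Consec ws y q
    y-q = (s ∷ p ∷ []) , _ , refl
    q-r : Consec ws q r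
    q-r = (s ∷ p ∷ y ∷ []) , _ , refl
    joined : ∀ u v → Consec ws u v → C u v ≡ true
    joined u v ([] , _ , refl)                     = C-flip ps
    joined u v ((_ ∷ []) , _ , refl)               = C-flip yp
    joined u v ((_ ∷ _ ∷ []) , _ , refl)           = yq
    joined u v ((_ ∷ _ ∷ _ ∷ []) , _ , refl)       = qr
    joined u v ((_ ∷ _ ∷ _ ∷ _ ∷ []) , _ , ())
    joined u v ((_ ∷ _ ∷ _ ∷ _ ∷ _ ∷ []) , _ , ())
    joined u v ((_ ∷ _ ∷ _ ∷ _ ∷ _ ∷ _ ∷ _) , _ , ())
    closed : ∀ u v → u ∈ ws → C u v ≡ true → Consec ws u v ⊎ Consec ws v u
    closed u v (here refl) Csv with count≡1-unique {h = C s} ds (C-flip ps) Csv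
    ... | refl = inj₁ s-p
    closed u v (there (here refl)) Cpv with count≡2-cases {h = C p} dp (C-flip yp) ps s≢y Cpv
    ... | inj₁ refl = inj₁ p-y
    ... | inj₂ refl = inj₂ s-p
    closed u v (there (there (here refl))) Cyv with count≡2-cases {h = C y} dy yq yp p≢q Cyv
    ... | inj₁ refl = inj₁ y-q
    ... | inj₂ refl = inj₂ p-y
    closed u v (there (there (there (here refl)))) Cqv with count≡2-cases {h = C q} dq (C-flip yq) qr r≢y Cqv
    ... | inj₁ refl = inj₂ y-q
    ... | inj₂ refl = inj₁ q-r
    closed u v (there (there (there (there (here refl))))) Crv
      with count≡1-unique {h = C r} dr (C-flip qr) Crv
    ... | refl = inj₂ q-r

  no-augmenting-edge : ∀ {a y} → (∀ C′ → IsPCC G C′ → edgeCount C′ ≤ edgeCount C) → adj G a y ≡ true →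
                       a ≢ y → C a y ≡ false → deg C a ≤ 1 → deg C y ≤ 1 → ⊥
  no-augmenting-edge {a} {y} C-max ay a≢y Cay da dy =
    <⇒≱ (≤-reflexive (sym (edgeCount-AddsEdge C+ay))) (C-max _ (IsPCC-extend {G = G} C-pcc C+ay ay da dy))
    where
    C+ay : AddsEdge C (addEdge C a y) a y
    C+ay = addEdge-AddsEdge a≢y λ
      { (inj₁ (refl , refl)) → Cay
      ; (inj₂ (refl , refl)) → trans (C-sym y a) Cay }

  module Swap {a b y q} (ab : IsolatedEdge C a b) (ay : adj G a y ≡ true) (y≢a : y ≢ a) (y≢b : y ≢ b)
              (dy : deg C y ≡ 2) (yq : C y q ≡ true) where
    open IsolatedEdge ab

    Cay : C a y ≡ false
    Cay = IsolatedEdge-absent ab y≢b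

    y≢q : y ≢ q
    y≢q = C-irrefl yq

    q≢a : q ≢ a
    q≢a refl = contradiction (trans (sym (C-flip yq)) Cay) λ ()

    D : EdgeRel n
    D = minusE C y q

    C′ : EdgeRel n
    C′ = addEdge D a y

    D+yq≡C : AddsEdge D C y q
    D+yq≡C = minusE-AddsEdge y≢q λ { (inj₁ (refl , refl)) → yq ; (inj₂ (refl , refl)) → C-flip yq }

    D+ay≡C′ : AddsEdge D C′ a y
    D+ay≡C′ = addEdge-AddsEdge (y≢a ∘ sym) λ
      { (inj₁ (refl , refl)) → cong (_∧ _) Cay
      ; (inj₂ (refl , refl)) → cong (_∧ _) (trans (C-sym y a) Cay) }

    da : deg C a ≡ 1
    da = IsolatedEdge-deg ab

    db : deg C b ≡ 1
    db = IsolatedEdge-deg (IsolatedEdge-flip C-sym ab)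

    dDa : deg D a ≡ 1
    dDa = trans (sym (deg-AddsEdge-other D+yq≡C (y≢a ∘ sym) (q≢a ∘ sym))) da

    dDy : deg D y ≡ 1
    dDy = suc-injective (trans (sym (deg-AddsEdge D+yq≡C)) dy)

    C′-pcc : IsPCC G C′
    C′-pcc = IsPCC-extend {G = G} (IsPCC-shrink {G = G} C-pcc D+yq≡C) D+ay≡C′ ay
                          (≤-reflexive dDa) (≤-reflexive dDy)

    C′-size : edgeCount C′ ≡ edgeCount C
    C′-size = trans (edgeCount-AddsEdge D+ay≡C′) (sym (edgeCount-AddsEdge D+yq≡C))

    d′a : deg C′ a ≡ 2
    d′a = trans (deg-AddsEdge D+ay≡C′) (cong suc dDa)

    d′y : deg C′ y ≡ 2
    d′y = trans (deg-AddsEdge (AddsEdge-swap D+ay≡C′)) (cong suc dDy)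

    d′-other : ∀ {v} → v ≢ a → v ≢ y → v ≢ q → deg C′ v ≡ deg C v
    d′-other v≢a v≢y v≢q =
      trans (deg-AddsEdge-other D+ay≡C′ v≢a v≢y) (sym (deg-AddsEdge-other D+yq≡C v≢y v≢q))

    C′-other : ∀ {v w} → v ≢ a → v ≢ y → w ≢ y → C′ v w ≡ C v w
    C′-other v≢a v≢y w≢y =
      trans (sym (AddsEdge.unchanged D+ay≡C′ [ v≢a ∘ proj₁ , v≢y ∘ proj₁ ]′))
            (AddsEdge.unchanged D+yq≡C [ v≢y ∘ proj₁ , w≢y ∘ proj₂ ]′)

    C′-end : ∀ {v} → deg C′ v ≡ 1 → v ≢ a × v ≢ y
    C′-end d′v = (λ { refl → contradiction (trans (sym d′a) d′v) λ () })
               , (λ { refl → contradiction (trans (sym d′y) d′v) λ () })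

    -- The swap kills the isolated edge ab, and q is the only vertex whose degree drops, so a new
    -- isolated edge would join q to an end r ≢ y of C, which ¬ EndBeyond C y q excludes.
    fewer-single-edges : ¬ EndBeyond C y q → singleEdges C′ < singleEdges C
    fewer-single-edges no-end =
      ∑-mono-< a (λ v → count-mono (single-kept v))
        (count-mono-< b (single-kept a)
          (single-not-end {A = C′} b λ e → contradiction (trans (sym d′a) e) λ ())
          (single-complete {A = C} edge da db))
      where
      single-kept : ∀ v w → single C′ v w ≡ true → single C v w ≡ true
      single-kept v w s′ with single-sound {A = C′} s′
      ... | C′vw , d′v , d′w with C′-end d′v | C′-end d′w
      ... | v≢a , v≢y | w≢a , w≢y = by-q (v ≟ q) (w ≟ q)
        where
        Cvw : C v w ≡ true
        Cvw = trans (sym (C′-other v≢a v≢y w≢y)) C′vw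
        by-q : Dec (v ≡ q) → Dec (w ≡ q) → single C v w ≡ true
        by-q (yes refl) _ =
          contradiction (w , Cvw , w≢y , trans (sym (d′-other w≢a w≢y (C-irrefl Cvw ∘ sym))) d′w) no-end
        by-q (no _) (yes refl) =
          contradiction (v , C-flip Cvw , v≢y , trans (sym (d′-other v≢a v≢y (C-irrefl Cvw))) d′v) no-end
        by-q (no v≢q) (no w≢q) = single-complete {A = C} Cvw
          (trans (sym (d′-other v≢a v≢y v≢q)) d′v) (trans (sym (d′-other w≢a w≢y w≢q)) d′w)

  neighbour-has-end-beyond : ∀ {a b y q} → Optimal G C → IsolatedEdge C a b → adj G a y ≡ true →
                             y ≢ a → y ≢ b → deg C y ≡ 2 → C y q ≡ true → EndBeyond C y q
  neighbour-has-end-beyond {y = y} {q} optimal ab ay y≢a y≢b dy yq =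
    decidable-stable (endBeyond? C y q) λ no-end →
      <⇒≱ (fewer-single-edges no-end) (fewest-single-edges C′ (C′-pcc , C′-max))
    where
    open Optimal optimal
    open Swap ab ay y≢a y≢b dy yq
    C′-max : ∀ A → IsPCC G A → edgeCount A ≤ edgeCount C′
    C′-max A A-pcc = subst (edgeCount A ≤_) (sym C′-size) (proj₂ maximum A A-pcc)

  isolated-edge-near-long-path : ∀ {a b y} → Optimal G C → IsolatedEdge C a b → adj G a y ≡ true →
                                 y ≢ a → y ≢ b → ∃[ ws ] (IsPathComp C ws × 4 ≤ length ws × IsInner ws y)
  isolated-edge-near-long-path {y = y} optimal ab ay y≢a y≢b with deg C y ≤? 1
  ... | yes dy≤1 = ⊥-elim (no-augmenting-edge (proj₂ (Optimal.maximum optimal)) ay (y≢a ∘ sym)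
                            (IsolatedEdge-absent ab y≢b) (≤-reflexive (IsolatedEdge-deg ab)) dy≤1)
  ... | no  dy≰1 = through-neighbours (count≡2-witnesses (C y) dy)
    where
    dy : deg C y ≡ 2
    dy = ≤-antisym (C-deg y) (≰⇒> dy≰1)
    end-beyond : ∀ {x} → C y x ≡ true → EndBeyond C y x
    end-beyond = neighbour-has-end-beyond optimal ab ay y≢a y≢b dy
    through-neighbours : ∃[ p ] ∃[ q ] (C y p ≡ true × C y q ≡ true × p ≢ q) →
                         ∃[ ws ] (IsPathComp C ws × 4 ≤ length ws × IsInner ws y)
    through-neighbours (p , q , yp , yq , p≢q) =
      long-path-through dy yp yq p≢q (end-beyond yp) (end-beyond yq)

Reach-exits : ∀ {n} {K : Mask n} {A : EdgeRel n} {S : Fin n → Set} → Decidable S →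
               ∀ {u v} → Reach K A u v → S u → ¬ S v → ∃[ x ] ∃[ y ] (S x × ¬ S y × A x y ≡ true)
Reach-exits S? (here _) Su ¬Sv = contradiction Su ¬Sv
Reach-exits S? (step {u} {w} _ uw w⇝v) Su ¬Sv with S? w
... | yes Sw = Reach-exits S? w⇝v Sw ¬Sv
... | no ¬Sw = u , w , Su , ¬Sw , uw

two-vertices-acyclic : ∀ {n} (G : Graph n) (a b : Fin n) → (∀ v → v ≡ a ⊎ v ≡ b) → Acyclic G
two-vertices-acyclic G a b only (u ∷ v ∷ w ∷ _) (_ , (u≢v ∷ u≢w ∷ _) ∷ (v≢w ∷ _) ∷ _ , _)
  with only u | only v | only w
... | inj₁ refl | inj₁ refl | _         = u≢v refl
... | inj₂ refl | inj₂ refl | _         = u≢v refl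
... | inj₁ refl | _         | inj₁ refl = u≢w refl
... | inj₂ refl | _         | inj₂ refl = u≢w refl
... | _         | inj₁ refl | inj₁ refl = v≢w refl
... | _         | inj₂ refl | inj₂ refl = v≢w refl
two-vertices-acyclic G a b only (_ ∷ [])     (s≤s () , _)
two-vertices-acyclic G a b only (_ ∷ _ ∷ []) (s≤s (s≤s ()) , _)

edge-leaving-pair : ∀ {n} {G : Graph n} → Connected G → ¬ IsTree G → ∀ a b →
                    ∃[ x ] ∃[ y ] ((x ≡ a ⊎ x ≡ b) × y ≢ a × y ≢ b × adj G x y ≡ true)
edge-leaving-pair {G = G} conn ¬tree a b with any? (λ v → ¬? (v ≟ a) ×-dec ¬? (v ≟ b))
... | no none = contradiction (conn , two-vertices-acyclic G a b only) ¬tree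
  where
  only : ∀ v → v ≡ a ⊎ v ≡ b
  only v with v ≟ a | v ≟ b
  ... | yes v≡a | _       = inj₁ v≡a
  ... | no  _   | yes v≡b = inj₂ v≡b
  ... | no  v≢a | no  v≢b = contradiction (v , v≢a , v≢b) none
... | yes (v , v≢a , v≢b)
  with Reach-exits (λ w → w ≟ a ⊎-dec w ≟ b) (conn a v) (inj₁ refl) [ v≢a , v≢b ]′
...   | x , y , x∈ab , y∉ab , xy = x , y , x∈ab , y∉ab ∘ inj₁ , y∉ab ∘ inj₂ , xy

Consec-pair : ∀ {n} {a b u v : Fin n} → Consec (a ∷ b ∷ []) u v → u ≡ a × v ≡ b
Consec-pair ([] , _ , refl) = refl , refl
Consec-pair ((_ ∷ []) , _ , ())
Consec-pair ((_ ∷ _ ∷ []) , _ , ())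
Consec-pair ((_ ∷ _ ∷ _ ∷ _) , _ , ())

pathComp-pair-isolated : ∀ {n} {C : EdgeRel n} {a b : Fin n} → IsPathComp C (a ∷ b ∷ []) → IsolatedEdge C a b
pathComp-pair-isolated {a = a} {b} (_ , (a≢b ∷ _) ∷ _ , joined , closed) = record
  { edge   = joined a b ([] , [] , refl)
  ; only-a = λ Caw → neighbour (closed _ _ (here refl) Caw)
  ; only-b = λ Cbw → neighbour′ (closed _ _ (there (here refl)) Cbw)
  }
  where
  neighbour : ∀ {w} → Consec (a ∷ b ∷ []) a w ⊎ Consec (a ∷ b ∷ []) w a → w ≡ b
  neighbour (inj₁ c) = proj₂ (Consec-pair c)
  neighbour (inj₂ c) = contradiction (proj₂ (Consec-pair c)) a≢b
  neighbour′ : ∀ {w} → Consec (a ∷ b ∷ []) b w ⊎ Consec (a ∷ b ∷ []) w b → w ≡ a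
  neighbour′ (inj₁ c) = contradiction (sym (proj₁ (Consec-pair c))) a≢b
  neighbour′ (inj₂ c) = proj₁ (Consec-pair c)

lemma12 : ∀ {n} (G : Graph n) → Connected G → ¬ IsTree G → Reduced G →
    (∀ C → IsMaxPCC G C → ¬ NumComp allV C 1) →
    ∃[ C ] (IsMaxPCC G C ×
      (∀ ws → IsPathComp C ws → length ws ≡ 2 →
        ∃[ x ] ∃[ y ] ∃[ ws' ] (x ∈ ws × adj G x y ≡ true ×
          IsPathComp C ws' × 4 ≤ length ws' × IsInner ws' y)))
lemma12 G conn ¬tree _ _ with optimal-exists G
... | C , optimal = C , Optimal.maximum optimal , near-long-path
  where
  C-pcc : IsPCC G C
  C-pcc = proj₁ (Optimal.maximum optimal)
  near-long-path : ∀ ws → IsPathComp C ws → length ws ≡ 2 →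
    ∃[ x ] ∃[ y ] ∃[ ws' ] (x ∈ ws × adj G x y ≡ true × IsPathComp C ws' × 4 ≤ length ws' × IsInner ws' y)
  near-long-path (a ∷ b ∷ []) ab refl with edge-leaving-pair conn ¬tree a b
  ... | x , y , inj₁ refl , y≢a , y≢b , xy =
    x , y , map₂ (λ long → here refl , xy , long)
                 (isolated-edge-near-long-path C-pcc optimal (pathComp-pair-isolated ab) xy y≢a y≢b)
  ... | x , y , inj₂ refl , y≢a , y≢b , xy =
    x , y , map₂ (λ long → there (here refl) , xy , long)
                 (isolated-edge-near-long-path C-pcc optimal
                   (IsolatedEdge-flip (C-sym {G = G} C-pcc) (pathComp-pair-isolated ab)) xy y≢b y≢a)
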